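{- Let $t\ge1$ and $0\le k,s\le\lfloor t/2\rfloor$ be integers, $n=\min(k,s)$ and $\alpha_i=t-s-k+2i$ for $0\le i\le n$ (so $\alpha_0=t-k-s$ and $\alpha_n=t-|s-k|$). Then the system $$x_0\alpha_0+\dots+x_n\alpha_n=2t,\qquad x_0+\dots+x_n=4,\qquad x_i\in\mathbb{Z},\ 0\le x_i\le 4,$$ has a solution if and only if $4\alpha_0\le 2t\le 4\alpha_n$. -}

module Defs where

open import Data.Nat using (ℕ; zero; suc; _+_; _*_; _∸_)
open import Data.Fin using (Fin; toℕ)
import Data.Fin as Fin

sumFin : (m : ℕ) → (Fin m → ℕ) → ℕ
sumFin zero    f = 0
sumFin (suc m) f = f Fin.zero + sumFin m (λ i → f (Fin.suc i))

-- α_i = t - s - k + 2 i.  Under the hypotheses k, s ≤ ⌊t/2⌋ we have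
-- k + s ≤ t, so the truncated subtraction is exact.
alpha : (t k s : ℕ) → ℕ → ℕ
alpha t k s i = t ∸ (s + k) + 2 * i

module Submission where

-- Write a for α₀ = t ∸ (s + k), so that α_i = a + 2 i, and view a
-- solution x as a distribution of "mass" Σ x_i = 4 on the points 0, …, n.
-- Its weighted sum then splits as  Σ x_i (a + 2 i) = 4 a + 2 D,  where
-- D = Σ x_i · i is the first moment of x (lemma affine-moment).  The moment
-- of a distribution of mass N on {0, …, n} always lies in [0, N n]
-- (moment≤), and conversely every D ≤ N n is the moment of some such
-- distribution (moment-reachable, by induction on n: either shift a
-- solution for D ∸ N one step to the right, or split the mass between the
-- points 0 and 1).  Hence the system is solvable iff 2 t = 4 a + 2 D for some
-- D ≤ 4 n, which is plain arithmetic equivalent to 4 α₀ ≤ 2 t ≤ 4 α_n.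
-- The entry bound x_i ≤ 4 is automatic since each entry is at most the mass.
-- The argument works for every a.

open import Defs
open import Data.Nat using (ℕ; suc; _+_; _*_; _≤_; _⊓_; ⌊_/2⌋)
open import Data.Fin using (Fin; toℕ)
open import Data.Product using (Σ; _×_)
open import Function.Bundles using (_⇔_)
open import Relation.Binary.PropositionalEquality using (_≡_)

open import Data.Nat using (zero; _∸_; z≤n; _≤?_)
open import Data.Nat.Properties
open import Data.Nat.Tactic.RingSolver using (solve-∀)
import Data.Fin as F
open import Data.Fin.Properties using (toℕ≤pred[n])
open import Data.Product using (_,_; proj₁; proj₂)
open import Relation.Nullary using (yes; no)
open import Relation.Binary.PropositionalEquality
  using (refl; sym; trans; cong; cong₂; module ≡-Reasoning)
open import Function.Bundles using (mk⇔)

moment : (m : ℕ) → (Fin m → ℕ) → ℕ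
moment m x = sumFin m (λ i → x i * toℕ i)

sumFin-cong : ∀ m {f g : Fin m → ℕ} → (∀ i → f i ≡ g i) → sumFin m f ≡ sumFin m g
sumFin-cong zero    eq = refl
sumFin-cong (suc m) eq = cong₂ _+_ (eq F.zero) (sumFin-cong m (λ i → eq (F.suc i)))

entry≤mass : ∀ m (x : Fin m → ℕ) (i : Fin m) → x i ≤ sumFin m x
entry≤mass (suc m) x F.zero    = m≤m+n (x F.zero) _
entry≤mass (suc m) x (F.suc i) =
  ≤-trans (entry≤mass m (λ j → x (F.suc j)) i) (m≤n+m _ (x F.zero))

affine-weights : ∀ m (x f : Fin m → ℕ) a d →
  sumFin m (λ i → x i * (a + d * f i)) ≡ sumFin m x * a + d * sumFin m (λ i → x i * f i)
affine-weights zero    x f a d = sym (*-zeroʳ d)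
affine-weights (suc m) x f a d = begin
    x₀ * (a + d * f₀) + sumFin m (λ i → x (F.suc i) * (a + d * f (F.suc i)))
  ≡⟨ cong (x₀ * (a + d * f₀) +_) (affine-weights m (λ i → x (F.suc i)) (λ i → f (F.suc i)) a d) ⟩
    x₀ * (a + d * f₀) + (S * a + d * M)
  ≡⟨ regroup x₀ f₀ a d S M ⟩
    (x₀ + S) * a + d * (x₀ * f₀ + M) ∎
  where
  open ≡-Reasoning
  x₀ = x F.zero
  f₀ = f F.zero
  S = sumFin m (λ i → x (F.suc i))
  M = sumFin m (λ i → x (F.suc i) * f (F.suc i))
  regroup : ∀ x₀ f₀ a d S M →
    x₀ * (a + d * f₀) + (S * a + d * M) ≡ (x₀ + S) * a + d * (x₀ * f₀ + M)
  regroup = solve-∀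

affine-moment : ∀ m (x : Fin m → ℕ) a d →
  sumFin m (λ i → x i * (a + d * toℕ i)) ≡ sumFin m x * a + d * moment m x
affine-moment m x a d = affine-weights m x toℕ a d

weighted≤ : ∀ m (x f : Fin m → ℕ) b → (∀ i → f i ≤ b) →
  sumFin m (λ i → x i * f i) ≤ sumFin m x * b
weighted≤ zero    x f b f≤b = z≤n
weighted≤ (suc m) x f b f≤b = ≤-trans
  (+-mono-≤ (*-monoʳ-≤ (x F.zero) (f≤b F.zero))
            (weighted≤ m (λ i → x (F.suc i)) (λ i → f (F.suc i)) b (λ i → f≤b (F.suc i))))
  (≤-reflexive (sym (*-distribʳ-+ b (x F.zero) _)))

moment≤ : ∀ n (x : Fin (suc n) → ℕ) → moment (suc n) x ≤ sumFin (suc n) x * n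
moment≤ n x = weighted≤ (suc n) x toℕ n toℕ≤pred[n]

shift : ∀ {m} → (Fin m → ℕ) → Fin (suc m) → ℕ
shift y F.zero    = 0
shift y (F.suc i) = y i

moment-shift : ∀ m (y : Fin m → ℕ) → moment (suc m) (shift y) ≡ sumFin m y + moment m y
moment-shift m y = begin
    sumFin m (λ i → y i * suc (toℕ i))
  ≡⟨ sumFin-cong m (λ i → cong (y i *_) (sym (cong suc (+-identityʳ (toℕ i))))) ⟩
    sumFin m (λ i → y i * (1 + 1 * toℕ i))
  ≡⟨ affine-moment m y 1 1 ⟩
    sumFin m y * 1 + 1 * moment m y
  ≡⟨ cong₂ _+_ (*-identityʳ (sumFin m y)) (*-identityˡ (moment m y)) ⟩
    sumFin m y + moment m y ∎
  where open ≡-Reasoning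

zeros : ∀ m → sumFin m (λ _ → 0) ≡ 0
zeros zero    = refl
zeros (suc m) = zeros m

two-point : ∀ n N D → D ≤ N →
  Σ (Fin (suc (suc n)) → ℕ) (λ x → (sumFin (suc (suc n)) x ≡ N) × (moment (suc (suc n)) x ≡ D))
two-point n N D D≤N = x , mass , first-moment
  where
  x : Fin (suc (suc n)) → ℕ
  x F.zero            = N ∸ D
  x (F.suc F.zero)    = D
  x (F.suc (F.suc _)) = 0
  mass : N ∸ D + (D + sumFin n (λ _ → 0)) ≡ N
  mass rewrite zeros n | +-identityʳ D = m∸n+n≡m D≤N
  first-moment : (N ∸ D) * 0 + (D * 1 + sumFin n (λ _ → 0)) ≡ D
  first-moment rewrite zeros n | *-zeroʳ (N ∸ D) | +-identityʳ (D * 1) = *-identityʳ D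

-- Distributions of mass N on {0, …, n} realise every moment D ≤ N n:
-- for D ≥ N shift a distribution with moment D ∸ N, otherwise use two-point.
moment-reachable : ∀ N n D → D ≤ N * n →
  Σ (Fin (suc n) → ℕ) (λ x → (sumFin (suc n) x ≡ N) × (moment (suc n) x ≡ D))
moment-reachable N zero D D≤N*0 = (λ _ → N) , +-identityʳ N , first-moment
  where
  first-moment : N * 0 + 0 ≡ D
  first-moment = trans (+-identityʳ (N * 0))
    (trans (*-zeroʳ N) (sym (n≤0⇒n≡0 (≤-trans D≤N*0 (≤-reflexive (*-zeroʳ N))))))
moment-reachable N (suc n) D D≤ with N ≤? D
... | no N≰D = two-point n N D (≰⇒≥ N≰D)
... | yes N≤D = shift y , mass , first-moment
  where
  D∸N≤ : D ∸ N ≤ N * n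
  D∸N≤ = ≤-trans (∸-monoˡ-≤ N D≤)
    (≤-reflexive (trans (cong (_∸ N) (*-suc N n)) (m+n∸m≡n N (N * n))))
  reached = moment-reachable N n (D ∸ N) D∸N≤
  y = proj₁ reached
  mass = proj₁ (proj₂ reached)
  first-moment : moment (suc (suc n)) (shift y) ≡ D
  first-moment = trans (moment-shift (suc n) y)
    (trans (cong₂ _+_ mass (proj₂ (proj₂ reached))) (m+[n∸m]≡n N≤D))

System : ℕ → ℕ → ℕ → Set
System a n t = Σ (Fin (suc n) → ℕ) (λ x →
    (sumFin (suc n) (λ i → x i * (a + 2 * toℕ i)) ≡ 2 * t)
  × (sumFin (suc n) x ≡ 4)
  × ((i : Fin (suc n)) → x i ≤ 4))

-- A solution has weighted sum 4 a + 2 D with D ≤ 4 n, so 2 t lies in [4 a, 4 (a + 2 n)].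
system⇒bounds : ∀ a n t → System a n t → (4 * (a + 2 * 0) ≤ 2 * t) × (2 * t ≤ 4 * (a + 2 * n))
system⇒bounds a n t (x , weighted , mass , _) =
    ≤-trans (≤-reflexive (cong (4 *_) (+-identityʳ a))) (≤-trans (m≤m+n (4 * a) (2 * D)) (≤-reflexive 2t≡))
  , ≤-trans (≤-reflexive (sym 2t≡))
      (≤-trans (+-monoʳ-≤ (4 * a) (*-monoʳ-≤ 2 D≤4n)) (≤-reflexive (expand a n)))
  where
  D = moment (suc n) x
  2t≡ : 4 * a + 2 * D ≡ 2 * t
  2t≡ = trans (cong (λ N → N * a + 2 * D) (sym mass))
              (trans (sym (affine-moment (suc n) x a 2)) weighted)
  D≤4n : D ≤ 4 * n
  D≤4n = ≤-trans (moment≤ n x) (≤-reflexive (cong (_* n) mass))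
  expand : ∀ a n → 4 * a + 2 * (4 * n) ≡ 4 * (a + 2 * n)
  expand = solve-∀

-- Conversely, for 4 a ≤ 2 t ≤ 4 (a + 2 n) realise the moment D = t ∸ 2 a.
bounds⇒system : ∀ a n t → 4 * (a + 2 * 0) ≤ 2 * t → 2 * t ≤ 4 * (a + 2 * n) → System a n t
bounds⇒system a n t lower upper =
  x , weighted , mass , (λ i → ≤-trans (entry≤mass (suc n) x i) (≤-reflexive mass))
  where
  2a≤t : 2 * a ≤ t
  2a≤t = *-cancelˡ-≤ 2 (≤-trans (≤-reflexive (double a)) lower)
    where double : ∀ a → 2 * (2 * a) ≡ 4 * (a + 2 * 0)
          double = solve-∀
  D = t ∸ 2 * a
  t≡ : 2 * a + D ≡ t
  t≡ = m+[n∸m]≡n 2a≤t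
  D≤4n : D ≤ 4 * n
  D≤4n = +-cancelˡ-≤ (2 * a) D (4 * n) (*-cancelˡ-≤ 2
    (≤-trans (≤-reflexive (cong (2 *_) t≡)) (≤-trans upper (≤-reflexive (halve a n)))))
    where halve : ∀ a n → 4 * (a + 2 * n) ≡ 2 * (2 * a + 4 * n)
          halve = solve-∀
  reached = moment-reachable 4 n D D≤4n
  x = proj₁ reached
  mass = proj₁ (proj₂ reached)
  weighted : sumFin (suc n) (λ i → x i * (a + 2 * toℕ i)) ≡ 2 * t
  weighted = begin
      sumFin (suc n) (λ i → x i * (a + 2 * toℕ i))
    ≡⟨ affine-moment (suc n) x a 2 ⟩
      sumFin (suc n) x * a + 2 * moment (suc n) x
    ≡⟨ cong₂ (λ N M → N * a + 2 * M) mass (proj₂ (proj₂ reached)) ⟩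
      4 * a + 2 * D
    ≡⟨ regroup a D ⟩
      2 * (2 * a + D)
    ≡⟨ cong (2 *_) t≡ ⟩
      2 * t ∎
    where
    open ≡-Reasoning
    regroup : ∀ a D → 4 * a + 2 * D ≡ 2 * (2 * a + D)
    regroup = solve-∀

proposition3 : (t k s : ℕ) → 1 ≤ t → k ≤ ⌊ t /2⌋ → s ≤ ⌊ t /2⌋ →
    (Σ (Fin (suc (k ⊓ s)) → ℕ) (λ x →
        (sumFin (suc (k ⊓ s)) (λ i → x i * alpha t k s (toℕ i)) ≡ 2 * t)
      × (sumFin (suc (k ⊓ s)) x ≡ 4)
      × ((i : Fin (suc (k ⊓ s))) → x i ≤ 4)))
    ⇔ ((4 * alpha t k s 0 ≤ 2 * t) × (2 * t ≤ 4 * alpha t k s (k ⊓ s)))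
proposition3 t k s _ _ _ = mk⇔
  (system⇒bounds (t ∸ (s + k)) (k ⊓ s) t)
  (λ (lower , upper) → bounds⇒system (t ∸ (s + k)) (k ⊓ s) t lower upper)
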